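{- Let $\mathbb{F}$ be any field, let $G=([n],E)$ be a directed graph, $\mathcal{S}_G=\langle\mathrm{E}_{i,j}\mid (i,j)\in E\rangle\le\mathrm{M}(n,\mathbb{F})$, and $r\in\{0,1,\dots,n\}$. Then $G$ is $r$-acyclic if and only if every matrix $B\in\mathcal{S}_G$ has at least $r$ zero eigenvalues (i.e. its characteristic polynomial is divisible by $x^r$).
   Context: Directed graph: $E\subseteq[n]\times[n]$, self-loops allowed (a self-loop is a cycle of length $1$). $G$ is $r$-acyclic if every collection of pairwise vertex-disjoint directed cycles of $G$ covers at most $n-r$ vertices. $\mathrm{E}_{i,j}$ is the elementary matrix with $1$ at $(i,j)$. -}

module Defs where

open import Level using (Level; _⊔_)
open import Algebra.Bundles using (CommutativeRing)
open import Data.Nat using (ℕ; zero; suc; _∸_; _≤_)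
open import Data.Fin using (Fin; zero; suc; punchIn; _≟_)
open import Data.Bool using (Bool; true; false; if_then_else_)
open import Data.List using (List; []; _∷_; length; concat)
open import Data.List.Relation.Unary.All using (All)
open import Data.List.Relation.Unary.Unique.Propositional using (Unique)
open import Data.Product using (Σ; ∃; _×_)
open import Data.Empty using (⊥)
open import Relation.Nullary using (¬_; does)
open import Relation.Binary.PropositionalEquality using (_≡_)

record Field (c ℓ : Level) : Set (Level.suc (c ⊔ ℓ)) where
  field
    commutativeRing : CommutativeRing c ℓ
  open CommutativeRing commutativeRing public
  field
    0≉1     : ¬ (0# ≈ 1#)
    inverse : ∀ x → ¬ (x ≈ 0#) → Σ Carrier (λ y → (x * y) ≈ 1#)

-- Directed graphs on [n] = Fin n, given by a (decidable) adjacency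
-- relation; self-loops allowed.

Graph : ℕ → Set
Graph n = Fin n → Fin n → Bool

-- Walk E s c vs : starting at the current vertex c, following the
-- vertices vs in order along edges, and then an edge back to s.
Walk : ∀ {n} → Graph n → Fin n → Fin n → List (Fin n) → Set
Walk E s c []       = E c s ≡ true
Walk E s c (w ∷ ws) = (E c w ≡ true) × Walk E s w ws

-- A directed cycle, given by its list of vertices v₀ v₁ … v_{k-1}
-- (k ≥ 1) with edges v₀→v₁→…→v_{k-1}→v₀.  (Distinctness of vertices is
-- imposed below via Unique on the whole collection.)  A self-loop is
-- the cycle [ v ] with E v v.
IsCycle : ∀ {n} → Graph n → List (Fin n) → Set
IsCycle E []       = ⊥
IsCycle E (v ∷ vs) = Walk E v v vs

DisjointCycles : ∀ {n} → Graph n → List (List (Fin n)) → Set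
DisjointCycles E cs = All (IsCycle E) cs × Unique (concat cs)

covered : ∀ {n} → List (List (Fin n)) → ℕ
covered cs = length (concat cs)

RAcyclic : ∀ {n} → Graph n → ℕ → Set
RAcyclic {n} E r = ∀ cs → DisjointCycles E cs → covered cs ≤ n ∸ r

module Det {a} {A : Set a} (_+_ _*_ : A → A → A) (-_ : A → A) (0# 1# : A) where

  sumFin : ∀ {n} → (Fin n → A) → A
  sumFin {zero}  f = 0#
  sumFin {suc n} f = f zero + sumFin (λ i → f (suc i))

  negPow : ℕ → A → A
  negPow zero    x = x
  negPow (suc k) x = - negPow k x

  det : ∀ n → (Fin n → Fin n → A) → A
  det zero    M = 1#
  det (suc n) M = sumFin (λ j → negPow (Data.Fin.toℕ j)
                     (M zero j * det n (λ i k → M (suc i) (punchIn j k))))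

module _ {c ℓ} (F : Field c ℓ) where
  open Field F

  Matrix : ℕ → Set c
  Matrix n = Fin n → Fin n → Carrier

  -- B ∈ S_G = span{ E_{i,j} | (i,j) ∈ E }:  B is a linear combination
  -- of the elementary matrices E_{i,j} with (i,j) an edge.
  InSpan : ∀ {n} → Graph n → Matrix n → Set (c ⊔ ℓ)
  InSpan {n} E B = Σ (Fin n → Fin n → Carrier) λ coef →
    ∀ i j → B i j ≈ (if E i j then coef i j else 0#)

  -- Polynomials: coefficient lists, lowest degree first.
  Poly : Set c
  Poly = List Carrier

  coeff : Poly → ℕ → Carrier
  coeff []       k       = 0#
  coeff (a ∷ p)  zero    = a
  coeff (a ∷ p)  (suc k) = coeff p k

  _+P_ : Poly → Poly → Poly
  []      +P q       = q
  (a ∷ p) +P []      = a ∷ p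
  (a ∷ p) +P (b ∷ q) = (a + b) ∷ (p +P q)

  scaleP : Carrier → Poly → Poly
  scaleP a []      = []
  scaleP a (b ∷ q) = (a * b) ∷ scaleP a q

  _*P_ : Poly → Poly → Poly
  []      *P q = []
  (a ∷ p) *P q = scaleP a q +P (0# ∷ (p *P q))

  -P_ : Poly → Poly
  -P []      = []
  -P (a ∷ p) = (- a) ∷ (-P p)

  constP : Carrier → Poly
  constP a = a ∷ []

  X : Poly
  X = 0# ∷ 1# ∷ []

  Xpow : ℕ → Poly
  Xpow zero    = constP 1#
  Xpow (suc r) = X *P Xpow r

  charPoly : ∀ {n} → Matrix n → Poly
  charPoly {n} B = Det.det _+P_ _*P_ -P_ [] (constP 1#) n
    (λ i j → (if does (i ≟ j) then X else []) +P (-P (constP (B i j))))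

  -- divisibility of polynomials (equality = coefficientwise ≈)
  _∣P_ : Poly → Poly → Set (c ⊔ ℓ)
  p ∣P q = Σ Poly λ s → ∀ k → coeff q k ≈ coeff (p *P s) k

  AtLeastZeroEigs : ∀ {n} → ℕ → Matrix n → Set (c ⊔ ℓ)
  AtLeastZeroEigs r B = Xpow r ∣P charPoly B

module Submission where

-- The coefficient of xᵈ in det (x I - B) is a signed sum over permutations σ of [n] together
-- with a d-element set D of fixed points of σ, of products of entries -B u (σ u) for u ∉ D.
-- For B ∈ S_G such a product can only be nonzero if u → σ u is an edge for every u ∉ D, and then
-- the cycles of σ outside D are disjoint cycles of G covering n - d vertices; so if G is
-- r-acyclic all coefficients below xʳ vanish.  Conversely, if disjoint cycles cover k > n - r
-- vertices, the permutation matrix of those cycles lies in S_G and its characteristic polynomial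
-- is ± xⁿ⁻ᵏ ∏ (x^ℓ - 1) over the cycle lengths ℓ, whose coefficient of xⁿ⁻ᵏ is ± 1 with n - k < r.
-- Both directions run along the Laplace expansion by successive rows, which builds σ row by row.

open import Defs
open import Data.Bool using (Bool; true; false; not; _∧_; _∨_; if_then_else_)
open import Data.Bool.Properties using (∧-zeroʳ; not-¬; ¬-not; not-injective)
import Data.Bool.Properties as Boolₚ
open import Data.Empty using (⊥; ⊥-elim)
open import Data.Fin using (Fin; zero; suc; toℕ; punchIn; punchOut; _≟_)
open import Data.Fin.Properties
  using (pigeonhole; any?; suc-injective; punchIn-injective; punchInᵢ≢i; punchIn-punchOut)
open import Data.List using (List; []; _∷_; _++_; concat; concatMap; map; length; drop)
  renaming (iterate to orbit)
open import Data.List.Properties using (length-++; length-iterate; map-++)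
open import Data.List.Membership.Propositional using (_∈_; _∉_)
open import Data.List.Membership.Propositional.Properties using (∈-++⁻; ∈-map⁺)
open import Data.List.Relation.Unary.All using (All; []; _∷_; lookup; tabulate)
import Data.List.Relation.Unary.All.Properties as Allₚ
open import Data.List.Relation.Unary.Any using (here; there)
open import Data.List.Relation.Unary.AllPairs using ([]; _∷_)
open import Data.List.Relation.Unary.Unique.Propositional using (Unique)
import Data.List.Relation.Unary.Unique.Propositional.Properties as Uniqueₚ
open import Data.List.Relation.Binary.Permutation.Propositional using (_↭_; ↭-sym; ↭-refl; ↭⇒↭ₛ)
import Data.List.Relation.Binary.Permutation.Propositional.Properties as ↭
open import Data.List.Relation.Binary.Permutation.Setoid.Properties using (Unique-resp-↭)
open import Data.Nat as Nat using (ℕ; zero; suc; _∸_; _≤_; _<_; z≤n; s≤s)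
import Data.Nat.Properties as ℕₚ
open import Data.Nat.GeneralisedArithmetic using (iterate)
open import Data.Product using (Σ; ∃; _×_; _,_; proj₁; proj₂)
open import Data.Sum using (_⊎_; inj₁; inj₂; [_,_])
open import Function using (id; _∘_; const; case_of_)
open import Function.Definitions using (Injective)
open import Relation.Nullary using (¬_; Dec; yes; no; does; contradiction)
open import Relation.Nullary.Decidable using (dec-true; dec-false)
open import Relation.Unary using (Pred; Decidable)
open import Relation.Binary.PropositionalEquality as ≡ using (_≡_; _≢_; cong; cong₂; subst)

module Counting where
  open Nat using (_+_)
  open ≡ using (refl; sym; trans; module ≡-Reasoning)
  open ℕₚ using (+-suc; ≤-trans; m≤n+m)

  does-true⇒ : ∀ {a} {A : Set a} (a? : Dec A) → does a? ≡ true → A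
  does-true⇒ (yes a) _ = a

  ∧-true⇒ : ∀ {a b} → a ∧ b ≡ true → a ≡ true × b ≡ true
  ∧-true⇒ {true} {true} _ = refl , refl

  module _ {n : ℕ} where
    open import Data.List.Membership.DecPropositional (_≟_ {n}) public using (_∈?_)

    update : ∀ {a} {A : Set a} → (Fin n → A) → Fin n → A → Fin n → A
    update f p x u = if does (u ≟ p) then x else f u

    update-same : ∀ {a} {A : Set a} (f : Fin n → A) p x → update f p x p ≡ x
    update-same f p x rewrite dec-true (p ≟ p) refl = refl

    update-other : ∀ {a} {A : Set a} (f : Fin n → A) p x {u} → u ≢ p → update f p x u ≡ f u
    update-other f p x {u} u≢p with u ≟ p
    ... | yes u≡p = ⊥-elim (u≢p u≡p)
    ... | no _    = refl

  count : ∀ {m} → (Fin m → Bool) → ℕ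
  count {zero}  f = 0
  count {suc m} f = (if f zero then 1 else 0) + count (λ i → f (suc i))

  count-cong : ∀ {m} {f g : Fin m → Bool} → (∀ u → f u ≡ g u) → count f ≡ count g
  count-cong {zero}  f≗g = refl
  count-cong {suc m} f≗g =
    cong₂ _+_ (cong (λ b → if b then 1 else 0) (f≗g zero)) (count-cong (λ i → f≗g (suc i)))

  count-false : ∀ {m} (f : Fin m → Bool) → (∀ u → f u ≡ false) → count f ≡ 0
  count-false {zero}  f f≗false = refl
  count-false {suc m} f f≗false rewrite f≗false zero =
    count-false (λ i → f (suc i)) (λ i → f≗false (suc i))

  count-pos : ∀ {m} (f : Fin m → Bool) u → f u ≡ true → 1 ≤ count f
  count-pos {suc m} f zero    fu rewrite fu = s≤s z≤n
  count-pos {suc m} f (suc u) fu =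
    ≤-trans (count-pos (λ i → f (suc i)) u fu) (m≤n+m _ (if f zero then 1 else 0))

  count-complement : ∀ {m} (f : Fin m → Bool) → count f + count (λ u → not (f u)) ≡ m
  count-complement {zero}  f = refl
  count-complement {suc m} f with f zero
  ... | true  = cong suc (count-complement (λ i → f (suc i)))
  ... | false = trans (+-suc _ _) (cong suc (count-complement (λ i → f (suc i))))

  count-split : ∀ {m} (f g : Fin m → Bool) →
    count f ≡ count (λ u → f u ∧ g u) + count (λ u → f u ∧ not (g u))
  count-split {zero}  f g = refl
  count-split {suc m} f g with f zero | g zero | count-split (λ i → f (suc i)) (λ i → g (suc i))
  ... | true  | true  | ih = cong suc ih
  ... | true  | false | ih = trans (cong suc ih) (sym (+-suc _ _))
  ... | false | _     | ih = ih

  count-∨-disjoint : ∀ {m} (f g : Fin m → Bool) → (∀ u → f u ≡ true → g u ≡ true → ⊥) →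
    count (λ u → f u ∨ g u) ≡ count f + count g
  count-∨-disjoint {zero}  f g disj = refl
  count-∨-disjoint {suc m} f g disj
    with f zero in f₀ | g zero in g₀
       | count-∨-disjoint (λ i → f (suc i)) (λ i → g (suc i)) (λ u → disj (suc u))
  ... | true  | true  | ih = ⊥-elim (disj zero f₀ g₀)
  ... | true  | false | ih = cong suc ih
  ... | false | true  | ih = trans (cong suc ih) (sym (+-suc _ _))
  ... | false | false | ih = ih

  count-singleton : ∀ {m} (o : Fin m) → count (λ u → does (u ≟ o)) ≡ 1
  count-singleton {suc m} zero    = cong suc (count-false {m} (λ i → does (suc i ≟ zero)) (λ _ → refl))
  count-singleton {suc m} (suc o) = trans (count-cong suc≟suc) (count-singleton o)
    where
    suc≟suc : ∀ u → does (suc u ≟ suc o) ≡ does (u ≟ o)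
    suc≟suc u with u ≟ o
    ... | yes _ = refl
    ... | no  _ = refl

  count-∈ : ∀ {m} (O : List (Fin m)) → Unique O → count (λ u → does (u ∈? O)) ≡ length O
  count-∈ {m} []      []         = count-false {m} _ (λ _ → refl)
  count-∈ (o ∷ O) (o∉O ∷ !O) = begin
    count (λ u → does (u ≟ o) ∨ does (u ∈? O))
      ≡⟨ count-∨-disjoint _ _ disjoint ⟩
    count (λ u → does (u ≟ o)) + count (λ u → does (u ∈? O))
      ≡⟨ cong₂ _+_ (count-singleton o) (count-∈ O !O) ⟩
    suc (length O)
      ∎
    where
    open ≡-Reasoning
    disjoint : ∀ u → does (u ≟ o) ≡ true → does (u ∈? O) ≡ true → ⊥
    disjoint u u≟o u∈O with does-true⇒ (u ≟ o) u≟o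
    ... | refl = lookup o∉O (does-true⇒ (u ∈? O) u∈O) refl

  count-update : ∀ {m} (f : Fin m → Bool) p → f p ≡ false → count (update f p true) ≡ suc (count f)
  count-update {suc m} f zero    fp rewrite fp = cong suc (count-cong {m} (λ _ → refl))
  count-update {suc m} f (suc p) fp = begin
    count (update f (suc p) true)                   ≡⟨ cong (head +_) (count-cong update-suc) ⟩
    head + count (update (λ i → f (suc i)) p true)  ≡⟨ cong (head +_) (count-update (λ i → f (suc i)) p fp) ⟩
    head + suc (count (λ i → f (suc i)))            ≡⟨ +-suc head _ ⟩
    suc (count f)                                   ∎
    where
    open ≡-Reasoning
    head = if f zero then 1 else 0
    update-suc : ∀ u → update f (suc p) true (suc u) ≡ update (λ i → f (suc i)) p true u
    update-suc u with u ≟ p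
    ... | yes _ = refl
    ... | no  _ = refl

open Counting

least-witness : ∀ {p} {P : Pred ℕ p} → Decidable P → ∀ {k} → P k →
  Σ ℕ λ q → P q × (∀ {q′} → q′ < q → ¬ P q′)
least-witness {P = P} P? {k} Pk = [ id , (λ none → ⊥-elim (none (ℕₚ.n<1+n k) Pk)) ] (search (suc k))
  where
  search : ∀ k → (Σ ℕ λ q → P q × (∀ {q′} → q′ < q → ¬ P q′)) ⊎ (∀ {q} → q < k → ¬ P q)
  search zero = inj₂ λ ()
  search (suc k) with search k
  ... | inj₁ least = inj₁ least
  ... | inj₂ none with P? k
  ...   | yes Pk = inj₁ (k , Pk , none)
  ...   | no ¬Pk = inj₂ λ q<1+k → [ none , (λ { ≡.refl → ¬Pk }) ] (ℕₚ.m<1+n⇒m<n∨m≡n q<1+k)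

module Orbits {n} (σ : Fin n → Fin n) (σ-injective : Injective _≡_ _≡_ σ) where
  open Nat using (_+_)
  open ≡ using (refl; sym; trans; module ≡-Reasoning)
  open ℕₚ
    using (n<1+n; m∸n+n≡m; <⇒≤; m<n⇒0<n∸m; ≤-trans; m∸n≤m; ≤-pred; m<n⇒m<1+n; <⇒≱; m≤n+m; ≤-refl)

  iterate-σ : ∀ k u → iterate σ (σ u) k ≡ σ (iterate σ u k)
  iterate-σ zero    u = refl
  iterate-σ (suc k) u = iterate-σ k (σ u)

  iterate-+ : ∀ a b u → iterate σ u (a + b) ≡ iterate σ (iterate σ u a) b
  iterate-+ zero    b u = refl
  iterate-+ (suc a) b u = iterate-+ a b (σ u)

  iterate-injective : ∀ k → Injective _≡_ _≡_ (λ u → iterate σ u k)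
  iterate-injective zero    eq = eq
  iterate-injective (suc k) eq = σ-injective (iterate-injective k eq)

  collision⇒return : ∀ {a b} v → a < b → iterate σ v a ≡ iterate σ v b → iterate σ v (b ∸ a) ≡ v
  collision⇒return {a} {b} v a<b eq = sym (iterate-injective a (begin
    iterate σ v a                       ≡⟨ eq ⟩
    iterate σ v b                       ≡⟨ cong (iterate σ v) (sym (m∸n+n≡m (<⇒≤ a<b))) ⟩
    iterate σ v (b ∸ a + a)             ≡⟨ iterate-+ (b ∸ a) a v ⟩
    iterate σ (iterate σ v (b ∸ a)) a   ∎))
    where open ≡-Reasoning

  returns : ∀ v → ∃ λ t → iterate σ v (suc t) ≡ v
  returns v with pigeonhole (n<1+n n) (λ i → iterate σ v (toℕ i))
  ... | i , j , i<j , eq = positive-return (m<n⇒0<n∸m i<j) (collision⇒return v i<j eq)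
    where
    positive-return : ∀ {t} → 0 < t → iterate σ v t ≡ v → ∃ λ t′ → iterate σ v (suc t′) ≡ v
    positive-return {suc t} _ ret = t , ret

  -- abstract: unfolding the pigeonhole search in later goals makes type checking run out of memory
  abstract
    first-return : ∀ v →
      Σ ℕ λ p → iterate σ v (suc p) ≡ v × (∀ {q} → q < p → iterate σ v (suc q) ≢ v)
    first-return v with returns v
    ... | t , ret = least-witness (λ q → iterate σ v (suc q) ≟ v) {t} ret

  ∈-orbit⁻ : ∀ {u k w} → w ∈ orbit σ u k → ∃ λ t → t < k × w ≡ iterate σ u t
  ∈-orbit⁻ {k = suc k} (here w≡u)  = 0 , s≤s z≤n , w≡u
  ∈-orbit⁻ {k = suc k} (there w∈) with ∈-orbit⁻ w∈
  ... | t , t<k , w≡σᵗ = suc t , s≤s t<k , w≡σᵗ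

  ∈-orbit⁺ : ∀ u {k t} → t < k → iterate σ u t ∈ orbit σ u k
  ∈-orbit⁺ u {suc k} {zero}  _         = here refl
  ∈-orbit⁺ u {suc k} {suc t} (s≤s t<k) = there (∈-orbit⁺ (σ u) t<k)

  orbit-unique : ∀ k u → (∀ {a b} → a < b → b < k → iterate σ u a ≢ iterate σ u b) →
    Unique (orbit σ u k)
  orbit-unique zero    u distinct = []
  orbit-unique (suc k) u distinct =
    tabulate u∉ ∷ orbit-unique k (σ u) (λ a<b b<k → distinct (s≤s a<b) (s≤s b<k))
    where
    u∉ : ∀ {w} → w ∈ orbit σ (σ u) k → u ≢ w
    u∉ w∈ with ∈-orbit⁻ w∈
    ... | t , t<k , refl = distinct (s≤s z≤n) (s≤s t<k)

  module CycleThrough (v : Fin n) where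

    period-1 : ℕ
    period-1 = proj₁ (first-return v)

    vertices : List (Fin n)
    vertices = orbit σ v (suc period-1)

    returns-after-period : iterate σ v (suc period-1) ≡ v
    returns-after-period = proj₁ (proj₂ (first-return v))

    no-early-return : ∀ {t} → 0 < t → t ≤ period-1 → iterate σ v t ≢ v
    no-early-return {suc q} _ q<p = proj₂ (proj₂ (first-return v)) q<p

    vertices-unique : Unique vertices
    vertices-unique = orbit-unique (suc period-1) v λ {a} {b} a<b b≤p eq →
      no-early-return (m<n⇒0<n∸m a<b) (≤-trans (m∸n≤m b a) (≤-pred b≤p)) (collision⇒return v a<b eq)

    σ⁻¹-closed : ∀ {u} → σ u ∈ vertices → u ∈ vertices
    σ⁻¹-closed σu∈ with ∈-orbit⁻ σu∈
    ... | zero  , _         , σu≡v  =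
      subst (_∈ vertices)
        (sym (σ-injective (trans (trans σu≡v (sym returns-after-period)) (iterate-σ period-1 v))))
        (∈-orbit⁺ v (n<1+n period-1))
    ... | suc t , s≤s t<p  , σu≡σᵗ⁺¹ =
      subst (_∈ vertices) (sym (σ-injective (trans σu≡σᵗ⁺¹ (iterate-σ t v))))
        (∈-orbit⁺ v (m<n⇒m<1+n t<p))

  Invariant : (Fin n → Bool) → Set
  Invariant T = ∀ u → T u ≡ true → T (σ u) ≡ true

  module _ (E : Graph n) where

    walk-orbit : ∀ {s} k c → (∀ t → E (iterate σ c t) (σ (iterate σ c t)) ≡ true) →
      iterate σ c (suc k) ≡ s → Walk E s c (orbit σ (σ c) k)
    walk-orbit zero    c edges refl = edges 0
    walk-orbit (suc k) c edges ret  = edges 0 , walk-orbit k (σ c) (λ t → edges (suc t)) ret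

    AlongEdges : (Fin n → Bool) → Set
    AlongEdges T = ∀ u → T u ≡ true → E u (σ u) ≡ true

    CycleCover : (Fin n → Bool) → Set
    CycleCover T = Σ (List (List (Fin n))) λ cs →
      DisjointCycles E cs × covered cs ≡ count T × (∀ {u} → u ∈ concat cs → T u ≡ true)

    module SplitOff (T : Fin n → Bool) (T-inv : Invariant T) (T-edges : AlongEdges T)
                    (v : Fin n) (Tv : T v ≡ true) where
      open CycleThrough v

      iterate-invariant : ∀ t {c} → T c ≡ true → T (iterate σ c t) ≡ true
      iterate-invariant zero    Tc = Tc
      iterate-invariant (suc t) Tc = iterate-invariant t (T-inv _ Tc)

      vertices⊆T : ∀ {u} → u ∈ vertices → T u ≡ true
      vertices⊆T u∈ with ∈-orbit⁻ u∈
      ... | t , _ , refl = iterate-invariant t Tv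

      is-cycle : IsCycle E vertices
      is-cycle = walk-orbit period-1 v (λ t → T-edges _ (iterate-invariant t Tv)) returns-after-period

      rest : Fin n → Bool
      rest u = T u ∧ not (does (u ∈? vertices))

      rest⇒T : ∀ {u} → rest u ≡ true → T u ≡ true
      rest⇒T {u} r = proj₁ (∧-true⇒ {T u} r)

      rest⇒∉ : ∀ {u} → rest u ≡ true → u ∉ vertices
      rest⇒∉ {u} = go (u ∈? vertices)
        where
        go : (u∈? : Dec (u ∈ vertices)) → T u ∧ not (does u∈?) ≡ true → u ∉ vertices
        go (no u∉) _ = u∉
        go (yes _) r = case proj₂ (∧-true⇒ {T u} r) of λ ()

      ∉⇒rest : ∀ {u} → T u ≡ true → u ∉ vertices → rest u ≡ true
      ∉⇒rest {u} Tu u∉ rewrite Tu | dec-false (u ∈? vertices) u∉ = refl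

      rest-invariant : Invariant rest
      rest-invariant u r = ∉⇒rest (T-inv u (rest⇒T r)) (λ σu∈ → rest⇒∉ r (σ⁻¹-closed σu∈))

      rest-edges : AlongEdges rest
      rest-edges u r = T-edges u (rest⇒T r)

      count-rest : count T ≡ length vertices + count rest
      count-rest = begin
        count T
          ≡⟨ count-split T (λ u → does (u ∈? vertices)) ⟩
        count (λ u → T u ∧ does (u ∈? vertices)) + count rest
          ≡⟨ cong (_+ count rest) (count-cong T∧∈≗∈) ⟩
        count (λ u → does (u ∈? vertices)) + count rest
          ≡⟨ cong (_+ count rest) (count-∈ vertices vertices-unique) ⟩
        length vertices + count rest
          ∎
        where
        open ≡-Reasoning
        T∧∈≗∈ : ∀ u → (T u ∧ does (u ∈? vertices)) ≡ does (u ∈? vertices)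
        T∧∈≗∈ u = absorb (u ∈? vertices)
          where
          absorb : (u∈? : Dec (u ∈ vertices)) → (T u ∧ does u∈?) ≡ does u∈?
          absorb (yes u∈) rewrite vertices⊆T u∈ = refl
          absorb (no  _)  = ∧-zeroʳ (T u)

      count-rest< : count rest < count T
      count-rest< = begin-strict
        count rest                    <⟨ s≤s (m≤n+m (count rest) period-1) ⟩
        suc period-1 + count rest     ≡⟨ cong (_+ count rest) (length-iterate σ v (suc period-1)) ⟨
        length vertices + count rest  ≡⟨ count-rest ⟨
        count T                       ∎
        where open ℕₚ.≤-Reasoning

      add-cycle : CycleCover rest → CycleCover T
      add-cycle (cs , (cycles , unique) , covers , ⊆rest) =
        vertices ∷ cs , (is-cycle ∷ cycles , Uniqueₚ.++⁺ vertices-unique unique disjoint) , covers′ , ⊆T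
        where
        disjoint : ∀ {u} → u ∈ vertices × u ∈ concat cs → ⊥
        disjoint (u∈ , u∈cs) = rest⇒∉ (⊆rest u∈cs) u∈
        covers′ : covered (vertices ∷ cs) ≡ count T
        covers′ = trans (length-++ vertices) (trans (cong (length vertices +_) covers) (sym count-rest))
        ⊆T : ∀ {u} → u ∈ vertices ++ concat cs → T u ≡ true
        ⊆T u∈ with ∈-++⁻ vertices u∈
        ... | inj₁ u∈vertices = vertices⊆T u∈vertices
        ... | inj₂ u∈cs       = rest⇒T (⊆rest u∈cs)

    cycleCover : ∀ fuel (T : Fin n → Bool) → count T ≤ fuel → Invariant T → AlongEdges T → CycleCover T
    cycleCover fuel T _ T-inv T-edges with any? (λ u → T u Boolₚ.≟ true)
    ... | no none = [] , ([] , []) , sym (count-false T λ u → ¬-not λ Tu → none (u , Tu)) , λ ()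
    cycleCover zero    T T≤0 _     _       | yes (v , Tv) = ⊥-elim (<⇒≱ (count-pos T v Tv) T≤0)
    cycleCover (suc f) T T≤f T-inv T-edges | yes (v , Tv) =
      add-cycle (cycleCover f rest (≤-pred (≤-trans count-rest< T≤f)) rest-invariant rest-edges)
      where open SplitOff T T-inv T-edges v Tv

    cycle-decomposition : ∀ (T : Fin n → Bool) → Invariant T → AlongEdges T →
      Σ (List (List (Fin n))) λ cs → DisjointCycles E cs × covered cs ≡ count T
    cycle-decomposition T T-inv T-edges with cycleCover (count T) T ≤-refl T-inv T-edges
    ... | cs , disjoint , covers , _ = cs , disjoint , covers

module PolynomialCoefficients {c ℓ} (F : Field c ℓ) where
  open Field F hiding (zero)
  open ℕₚ using (_<?_; ≮⇒≥; m+[n∸m]≡n; ≤-trans)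
  open import Algebra.Properties.Ring ring using (-0#≈0#)
  open import Relation.Binary.Reasoning.Setoid setoid

  infixl 6 _+ₚ_
  infixl 7 _*ₚ_
  infix  8 -ₚ_

  _+ₚ_ _*ₚ_ : Poly F → Poly F → Poly F
  _+ₚ_ = _+P_ F
  _*ₚ_ = _*P_ F

  -ₚ_ : Poly F → Poly F
  -ₚ_ = -P_ F

  VanishesBelow : (ℕ → Carrier) → ℕ → Set ℓ
  VanishesBelow f k = ∀ d → d < k → f d ≈ 0#

  shift : (ℕ → Carrier) → ℕ → Carrier
  shift f zero    = 0#
  shift f (suc d) = f d

  coeff-+ₚ : ∀ p q k → coeff F (p +ₚ q) k ≈ coeff F p k + coeff F q k
  coeff-+ₚ []      q       k       = sym (+-identityˡ _)
  coeff-+ₚ (a ∷ p) []      k       = sym (+-identityʳ _)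
  coeff-+ₚ (a ∷ p) (b ∷ q) zero    = refl
  coeff-+ₚ (a ∷ p) (b ∷ q) (suc k) = coeff-+ₚ p q k

  coeff-negₚ : ∀ p k → coeff F (-ₚ p) k ≈ - coeff F p k
  coeff-negₚ []      k       = sym -0#≈0#
  coeff-negₚ (a ∷ p) zero    = refl
  coeff-negₚ (a ∷ p) (suc k) = coeff-negₚ p k

  coeff-scaleP : ∀ a q k → coeff F (scaleP F a q) k ≈ a * coeff F q k
  coeff-scaleP a []      k       = sym (zeroʳ a)
  coeff-scaleP a (b ∷ q) zero    = refl
  coeff-scaleP a (b ∷ q) (suc k) = coeff-scaleP a q k

  coeff-0∷ : ∀ p k → coeff F (0# ∷ p) k ≈ shift (coeff F p) k
  coeff-0∷ p zero    = refl
  coeff-0∷ p (suc k) = refl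

  coeff-∷-*ₚ : ∀ a p q k → coeff F ((a ∷ p) *ₚ q) k ≈ a * coeff F q k + shift (coeff F (p *ₚ q)) k
  coeff-∷-*ₚ a p q k = begin
    coeff F (scaleP F a q +ₚ (0# ∷ p *ₚ q)) k              ≈⟨ coeff-+ₚ (scaleP F a q) _ k ⟩
    coeff F (scaleP F a q) k + coeff F (0# ∷ p *ₚ q) k     ≈⟨ +-cong (coeff-scaleP a q k) (coeff-0∷ _ k) ⟩
    a * coeff F q k + shift (coeff F (p *ₚ q)) k            ∎

  shift-zero : ∀ {f} → (∀ k → f k ≈ 0#) → ∀ k → shift f k ≈ 0#
  shift-zero f≈0 zero    = refl
  shift-zero f≈0 (suc k) = f≈0 k

  vanishesBelow-shift : ∀ {f k} → VanishesBelow f k → VanishesBelow (shift f) (suc k)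
  vanishesBelow-shift f≈0 zero    _         = refl
  vanishesBelow-shift f≈0 (suc d) (s≤s d<k) = f≈0 d d<k

  vanishesBelow-≤ : ∀ {f j k} → j ≤ k → VanishesBelow f k → VanishesBelow f j
  vanishesBelow-≤ j≤k f≈0 d d<j = f≈0 d (≤-trans d<j j≤k)

  coeff-*ₚ-zero : ∀ p → (∀ k → coeff F p k ≈ 0#) → ∀ q k → coeff F (p *ₚ q) k ≈ 0#
  coeff-*ₚ-zero []      p≈0 q k = refl
  coeff-*ₚ-zero (a ∷ p) p≈0 q k = begin
    coeff F ((a ∷ p) *ₚ q) k                      ≈⟨ coeff-∷-*ₚ a p q k ⟩
    a * coeff F q k + shift (coeff F (p *ₚ q)) k  ≈⟨ +-cong (trans (*-congʳ (p≈0 0)) (zeroˡ _))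
                                                       (shift-zero (coeff-*ₚ-zero p (λ k → p≈0 (suc k)) q) k) ⟩
    0# + 0#                                       ≈⟨ +-identityˡ 0# ⟩
    0#                                            ∎

  coeff-*ₚ-constant : ∀ p → (∀ k → coeff F p (suc k) ≈ 0#) →
    ∀ q k → coeff F (p *ₚ q) k ≈ coeff F p 0 * coeff F q k
  coeff-*ₚ-constant []      _   q k = sym (zeroˡ _)
  coeff-*ₚ-constant (a ∷ p) p≈a q k = begin
    coeff F ((a ∷ p) *ₚ q) k                      ≈⟨ coeff-∷-*ₚ a p q k ⟩
    a * coeff F q k + shift (coeff F (p *ₚ q)) k  ≈⟨ +-congˡ (shift-zero (coeff-*ₚ-zero p p≈a q) k) ⟩
    a * coeff F q k + 0#                          ≈⟨ +-identityʳ _ ⟩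
    a * coeff F q k                               ∎

  coeff-*ₚ-linear : ∀ p → (∀ k → coeff F p (suc (suc k)) ≈ 0#) → ∀ q k →
    coeff F (p *ₚ q) k ≈ coeff F p 0 * coeff F q k + coeff F p 1 * shift (coeff F q) k
  coeff-*ₚ-linear []      _   q k = sym (trans (+-cong (zeroˡ _) (zeroˡ _)) (+-identityˡ 0#))
  coeff-*ₚ-linear (a ∷ p) p≈ab q k = trans (coeff-∷-*ₚ a p q k) (+-congˡ (tail k))
    where
    tail : ∀ k → shift (coeff F (p *ₚ q)) k ≈ coeff F p 0 * shift (coeff F q) k
    tail zero    = sym (zeroʳ _)
    tail (suc k) = coeff-*ₚ-constant p p≈ab q k

  *ₚ-congˡ : ∀ p p′ → (∀ k → coeff F p k ≈ coeff F p′ k) → ∀ q k → coeff F (p *ₚ q) k ≈ coeff F (p′ *ₚ q) k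
  *ₚ-congˡ []      []        p≈p′ q k = refl
  *ₚ-congˡ []      (a′ ∷ p′) p≈p′ q k = sym (coeff-*ₚ-zero (a′ ∷ p′) (λ k → sym (p≈p′ k)) q k)
  *ₚ-congˡ (a ∷ p) []        p≈p′ q k = coeff-*ₚ-zero (a ∷ p) p≈p′ q k
  *ₚ-congˡ (a ∷ p) (a′ ∷ p′) p≈p′ q k = begin
    coeff F ((a ∷ p) *ₚ q) k                         ≈⟨ coeff-∷-*ₚ a p q k ⟩
    a * coeff F q k + shift (coeff F (p *ₚ q)) k     ≈⟨ +-cong (*-congʳ (p≈p′ 0)) (tail k) ⟩
    a′ * coeff F q k + shift (coeff F (p′ *ₚ q)) k   ≈⟨ coeff-∷-*ₚ a′ p′ q k ⟨
    coeff F ((a′ ∷ p′) *ₚ q) k                       ∎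
    where
    tail : ∀ k → shift (coeff F (p *ₚ q)) k ≈ shift (coeff F (p′ *ₚ q)) k
    tail zero    = refl
    tail (suc k) = *ₚ-congˡ p p′ (λ k → p≈p′ (suc k)) q k

  coeff-X*ₚ : ∀ q k → coeff F (X F *ₚ q) k ≈ shift (coeff F q) k
  coeff-X*ₚ q k = begin
    coeff F (X F *ₚ q) k                        ≈⟨ coeff-*ₚ-linear (X F) (λ _ → refl) q k ⟩
    0# * coeff F q k + 1# * shift (coeff F q) k ≈⟨ +-cong (zeroˡ _) (*-identityˡ _) ⟩
    0# + shift (coeff F q) k                    ≈⟨ +-identityˡ _ ⟩
    shift (coeff F q) k                         ∎

  coeff-Xpow-suc-*ₚ : ∀ r s k → coeff F (Xpow F (suc r) *ₚ s) k ≈ shift (coeff F (Xpow F r *ₚ s)) k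
  coeff-Xpow-suc-*ₚ r s k = begin
    coeff F ((X F *ₚ Xpow F r) *ₚ s) k
      ≈⟨ *ₚ-congˡ (X F *ₚ Xpow F r) (0# ∷ Xpow F r) X*ₚ≈0∷ s k ⟩
    coeff F ((0# ∷ Xpow F r) *ₚ s) k                      ≈⟨ coeff-∷-*ₚ 0# (Xpow F r) s k ⟩
    0# * coeff F s k + shift (coeff F (Xpow F r *ₚ s)) k  ≈⟨ +-congʳ (zeroˡ _) ⟩
    0# + shift (coeff F (Xpow F r *ₚ s)) k                ≈⟨ +-identityˡ _ ⟩
    shift (coeff F (Xpow F r *ₚ s)) k                     ∎
    where
    X*ₚ≈0∷ : ∀ k → coeff F (X F *ₚ Xpow F r) k ≈ coeff F (0# ∷ Xpow F r) k
    X*ₚ≈0∷ k = trans (coeff-X*ₚ (Xpow F r) k) (sym (coeff-0∷ (Xpow F r) k))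

  coeff-Xpow-*ₚ-low : ∀ r s → VanishesBelow (coeff F (Xpow F r *ₚ s)) r
  coeff-Xpow-*ₚ-low (suc r) s d d<r =
    trans (coeff-Xpow-suc-*ₚ r s d) (vanishesBelow-shift (coeff-Xpow-*ₚ-low r s) d d<r)

  coeff-Xpow-*ₚ-high : ∀ r s k → coeff F (Xpow F r *ₚ s) (r Nat.+ k) ≈ coeff F s k
  coeff-Xpow-*ₚ-high zero    s k = trans (coeff-*ₚ-constant (constP F 1#) (λ _ → refl) s k) (*-identityˡ _)
  coeff-Xpow-*ₚ-high (suc r) s k = trans (coeff-Xpow-suc-*ₚ r s (suc (r Nat.+ k))) (coeff-Xpow-*ₚ-high r s k)

  coeff-drop : ∀ r p k → coeff F (drop r p) k ≡ coeff F p (r Nat.+ k)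
  coeff-drop zero    p       k = ≡.refl
  coeff-drop (suc r) []      k = ≡.refl
  coeff-drop (suc r) (a ∷ p) k = coeff-drop r p k

  Xpow∣ₚ⇒vanishesBelow : ∀ r p → _∣P_ F (Xpow F r) p → VanishesBelow (coeff F p) r
  Xpow∣ₚ⇒vanishesBelow r p (s , p≈) d d<r = trans (p≈ d) (coeff-Xpow-*ₚ-low r s d d<r)

  vanishesBelow⇒Xpow∣ₚ : ∀ r p → VanishesBelow (coeff F p) r → _∣P_ F (Xpow F r) p
  vanishesBelow⇒Xpow∣ₚ r p p≈0 = drop r p , p≈
    where
    p≈ : ∀ k → coeff F p k ≈ coeff F (Xpow F r *ₚ drop r p) k
    p≈ k with k <? r
    ... | yes k<r = trans (p≈0 k k<r) (sym (coeff-Xpow-*ₚ-low r _ k k<r))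
    ... | no  k≮r = ≡.subst (λ k → coeff F p k ≈ coeff F (Xpow F r *ₚ drop r p) k) (m+[n∸m]≡n (≮⇒≥ k≮r))
                      (sym (trans (coeff-Xpow-*ₚ-high r _ (k ∸ r)) (reflexive (coeff-drop r p (k ∸ r)))))

module DeterminantCoefficients {c ℓ} (F : Field c ℓ) where
  open Field F hiding (zero)
  open PolynomialCoefficients F
  open import Algebra.Properties.Ring ring using (-0#≈0#; -‿involutive)
  open import Relation.Binary.Reasoning.Setoid setoid

  module Scalar = Det _+_ _*_ -_ 0# 1#
  module Polynomial = Det _+ₚ_ _*ₚ_ -ₚ_ [] (constP F 1#)
  open Scalar using (sumFin; negPow)

  minor : ∀ {m a} {A : Set a} → (Fin (suc m) → Fin (suc m) → A) → Fin (suc m) → Fin m → Fin m → A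
  minor M j i k = M (suc i) (punchIn j k)

  mulLinear : Carrier → Carrier → (ℕ → Carrier) → ℕ → Carrier
  mulLinear a b f d = a * f d + b * shift f d

  -- coefficients of det (A + x D), expanded along the first row as in Det.det
  detCoeff : ∀ m → Matrix F m → Matrix F m → ℕ → Carrier
  detCoeff zero    A D zero    = 1#
  detCoeff zero    A D (suc d) = 0#
  detCoeff (suc m) A D d =
    sumFin λ j → negPow (toℕ j) (mulLinear (A zero j) (D zero j) (detCoeff m (minor A j) (minor D j)) d)

  sumFin-cong : ∀ {m} {f g : Fin m → Carrier} → (∀ j → f j ≈ g j) → sumFin f ≈ sumFin g
  sumFin-cong {zero}  f≈g = refl
  sumFin-cong {suc m} f≈g = +-cong (f≈g zero) (sumFin-cong (λ j → f≈g (suc j)))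

  negPow-cong : ∀ k {x y} → x ≈ y → negPow k x ≈ negPow k y
  negPow-cong zero    x≈y = x≈y
  negPow-cong (suc k) x≈y = -‿cong (negPow-cong k x≈y)

  shift-cong : ∀ {f g} → (∀ d → f d ≈ g d) → ∀ d → shift f d ≈ shift g d
  shift-cong f≈g zero    = refl
  shift-cong f≈g (suc d) = f≈g d

  mulLinear-cong : ∀ {a a′ b b′ f g} → a ≈ a′ → b ≈ b′ → (∀ d → f d ≈ g d) →
    ∀ d → mulLinear a b f d ≈ mulLinear a′ b′ g d
  mulLinear-cong a≈a′ b≈b′ f≈g d = +-cong (*-cong a≈a′ (f≈g d)) (*-cong b≈b′ (shift-cong f≈g d))

  detCoeff-cong : ∀ m {A A′ D D′ : Matrix F m} → (∀ i j → A i j ≈ A′ i j) → (∀ i j → D i j ≈ D′ i j) →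
    ∀ d → detCoeff m A D d ≈ detCoeff m A′ D′ d
  detCoeff-cong zero    A≈ D≈ zero    = refl
  detCoeff-cong zero    A≈ D≈ (suc d) = refl
  detCoeff-cong (suc m) A≈ D≈ d = sumFin-cong λ j → negPow-cong (toℕ j)
    (mulLinear-cong (A≈ zero j) (D≈ zero j)
      (detCoeff-cong m (λ i k → A≈ (suc i) (punchIn j k)) (λ i k → D≈ (suc i) (punchIn j k))) d)

  coeff-sumFin : ∀ {m} (f : Fin m → Poly F) d →
    coeff F (Polynomial.sumFin f) d ≈ sumFin (λ j → coeff F (f j) d)
  coeff-sumFin {zero}  f d = refl
  coeff-sumFin {suc m} f d = trans (coeff-+ₚ (f zero) _ d) (+-congˡ (coeff-sumFin (λ j → f (suc j)) d))

  coeff-negPow : ∀ k p d → coeff F (Polynomial.negPow k p) d ≈ negPow k (coeff F p d)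
  coeff-negPow zero    p d = refl
  coeff-negPow (suc k) p d = trans (coeff-negₚ (Polynomial.negPow k p) d) (-‿cong (coeff-negPow k p d))

  coeff-det : ∀ m (M : Fin m → Fin m → Poly F) → (∀ i j k → coeff F (M i j) (suc (suc k)) ≈ 0#) →
    ∀ d → coeff F (Polynomial.det m M) d ≈ detCoeff m (λ i j → coeff F (M i j) 0) (λ i j → coeff F (M i j) 1) d
  coeff-det zero    M linear zero    = refl
  coeff-det zero    M linear (suc d) = refl
  coeff-det (suc m) M linear d = begin
    coeff F (Polynomial.sumFin λ j → Polynomial.negPow (toℕ j) (M zero j *ₚ Polynomial.det m (minor M j))) d
      ≈⟨ coeff-sumFin (λ j → Polynomial.negPow (toℕ j) (M zero j *ₚ Polynomial.det m (minor M j))) d ⟩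
    sumFin (λ j → coeff F (Polynomial.negPow (toℕ j) (M zero j *ₚ Polynomial.det m (minor M j))) d)
      ≈⟨ sumFin-cong (λ j → trans (coeff-negPow (toℕ j) (M zero j *ₚ Polynomial.det m (minor M j)) d)
                                   (negPow-cong (toℕ j) (expand j))) ⟩
    detCoeff (suc m) (λ i j → coeff F (M i j) 0) (λ i j → coeff F (M i j) 1) d
      ∎
    where
    expand : ∀ j → coeff F (M zero j *ₚ Polynomial.det m (minor M j)) d ≈
      mulLinear (coeff F (M zero j) 0) (coeff F (M zero j) 1)
        (detCoeff m (minor (λ i j → coeff F (M i j) 0) j) (minor (λ i j → coeff F (M i j) 1) j)) d
    expand j = trans (coeff-*ₚ-linear (M zero j) (linear zero j) _ d)
      (mulLinear-cong refl refl (coeff-det m (minor M j) (λ i k → linear (suc i) (punchIn j k))) d)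

  sumFin-zero : ∀ {m} (f : Fin m → Carrier) → (∀ j → f j ≈ 0#) → sumFin f ≈ 0#
  sumFin-zero {zero}  f f≈0 = refl
  sumFin-zero {suc m} f f≈0 =
    trans (+-cong (f≈0 zero) (sumFin-zero (λ j → f (suc j)) (λ j → f≈0 (suc j)))) (+-identityˡ 0#)

  sumFin-single : ∀ {m} (f : Fin m → Carrier) j₀ → (∀ j → j ≢ j₀ → f j ≈ 0#) → sumFin f ≈ f j₀
  sumFin-single {suc m} f zero     f≈0 =
    trans (+-congˡ (sumFin-zero _ (λ j → f≈0 (suc j) λ ()))) (+-identityʳ _)
  sumFin-single {suc m} f (suc j₀) f≈0 = trans (+-congʳ (f≈0 zero λ ())) (trans (+-identityˡ _)
    (sumFin-single (λ j → f (suc j)) j₀ (λ j j≢j₀ → f≈0 (suc j) λ { ≡.refl → j≢j₀ ≡.refl })))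

  negPow-zero : ∀ k {x} → x ≈ 0# → negPow k x ≈ 0#
  negPow-zero zero    x≈0 = x≈0
  negPow-zero (suc k) x≈0 = trans (-‿cong (negPow-zero k x≈0)) -0#≈0#

  IsSign : Carrier → Set ℓ
  IsSign x = x ≈ 1# ⊎ x ≈ - 1#

  IsSign-resp : ∀ {x y} → x ≈ y → IsSign x → IsSign y
  IsSign-resp x≈y (inj₁ x≈1)  = inj₁ (trans (sym x≈y) x≈1)
  IsSign-resp x≈y (inj₂ x≈-1) = inj₂ (trans (sym x≈y) x≈-1)

  IsSign-neg : ∀ {x} → IsSign x → IsSign (- x)
  IsSign-neg (inj₁ x≈1)  = inj₂ (-‿cong x≈1)
  IsSign-neg (inj₂ x≈-1) = inj₁ (trans (-‿cong x≈-1) (-‿involutive 1#))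

  IsSign-negPow : ∀ k {x} → IsSign x → IsSign (negPow k x)
  IsSign-negPow zero    s = s
  IsSign-negPow (suc k) s = IsSign-neg (IsSign-negPow k s)

  IsSign⇒≉0 : ∀ {x} → IsSign x → ¬ x ≈ 0#
  IsSign⇒≉0 (inj₁ x≈1)  x≈0 = 0≉1 (trans (sym x≈0) x≈1)
  IsSign⇒≉0 (inj₂ x≈-1) x≈0 = 0≉1 (trans (sym -0#≈0#) (trans (-‿cong (trans (sym x≈0) x≈-1)) (-‿involutive 1#)))

  *-vanishesBelow : ∀ {a f k} → a ≈ 0# ⊎ VanishesBelow f k → VanishesBelow (λ d → a * f d) k
  *-vanishesBelow (inj₁ a≈0) d _   = trans (*-congʳ a≈0) (zeroˡ _)
  *-vanishesBelow (inj₂ f≈0) d d<k = trans (*-congˡ (f≈0 d d<k)) (zeroʳ _)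

  mulLinear-vanishesBelow : ∀ {a b f k} → a ≈ 0# ⊎ VanishesBelow f k → b ≈ 0# ⊎ VanishesBelow (shift f) k →
    VanishesBelow (mulLinear a b f) k
  mulLinear-vanishesBelow a≈0⊎ b≈0⊎ d d<k =
    trans (+-cong (*-vanishesBelow a≈0⊎ d d<k) (*-vanishesBelow b≈0⊎ d d<k)) (+-identityˡ 0#)

  δ : ∀ {n} → Fin n → Fin n → Carrier
  δ i j = if does (i ≟ j) then 1# else 0#

  δ-≢ : ∀ {n} {i j : Fin n} → i ≢ j → δ i j ≈ 0#
  δ-≢ {i = i} {j} i≢j with i ≟ j
  ... | yes i≡j = contradiction i≡j i≢j
  ... | no  _   = refl

  δ-≡ : ∀ {n} (i : Fin n) → δ i i ≈ 1#
  δ-≡ i rewrite dec-true (i ≟ i) ≡.refl = refl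

  sub : ∀ {m n} → Matrix F n → (Fin m → Fin n) → (Fin m → Fin n) → Matrix F m
  sub M rows cols i k = M (rows i) (cols k)

  charMinorCoeff : ∀ {m n} → Matrix F n → (Fin m → Fin n) → (Fin m → Fin n) → ℕ → Carrier
  charMinorCoeff {m} B rows cols = detCoeff m (sub (λ u v → - B u v) rows cols) (sub δ rows cols)

  laplaceTerm : ∀ {m n} → Matrix F n → (rows cols : Fin (suc m) → Fin n) → Fin (suc m) → ℕ → Carrier
  laplaceTerm B rows cols j = mulLinear (- B (rows zero) (cols j)) (δ (rows zero) (cols j))
    (charMinorCoeff B (rows ∘ suc) (cols ∘ punchIn j))

  charMinorCoeff-vanishesBelow : ∀ {m n} (B : Matrix F n) (rows cols : Fin (suc m) → Fin n) {k} →
    (∀ j → VanishesBelow (laplaceTerm B rows cols j) k) → VanishesBelow (charMinorCoeff B rows cols) k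
  charMinorCoeff-vanishesBelow B rows cols terms≈0 d d<k = sumFin-zero _ λ j → negPow-zero (toℕ j) (terms≈0 j d d<k)

  charMatrix : ∀ {n} → Matrix F n → Fin n → Fin n → Poly F
  charMatrix B i j = (if does (i ≟ j) then X F else []) +ₚ -ₚ constP F (B i j)

  coeff-charPoly : ∀ {n} (B : Matrix F n) d → coeff F (charPoly F B) d ≈ charMinorCoeff B id id d
  coeff-charPoly {n} B d =
    trans (coeff-det n (charMatrix B) linear d) (detCoeff-cong n constant-coeff linear-coeff d)
    where
    linear : ∀ i j k → coeff F (charMatrix B i j) (suc (suc k)) ≈ 0#
    linear i j k with does (i ≟ j)
    ... | true  = refl
    ... | false = refl
    constant-coeff : ∀ i j → coeff F (charMatrix B i j) 0 ≈ - B i j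
    constant-coeff i j with does (i ≟ j)
    ... | true  = +-identityˡ _
    ... | false = refl
    linear-coeff : ∀ i j → coeff F (charMatrix B i j) 1 ≈ δ i j
    linear-coeff i j with does (i ≟ j)
    ... | true  = refl
    ... | false = refl

-- After expanding det (x I - B) along some rows, the current minor has rows `rows` and columns
-- `cols`; every expanded row u was matched with the column σ u, and diag marks the rows where
-- the x of the diagonal entry, rather than -B u (σ u), was taken.
module ExpansionHistory {n} (E : Graph n) where
  open ≡ using (refl; sym; trans)

  Expanded : ∀ {m} → (Fin m → Fin n) → Fin n → Set
  Expanded rows u = ∀ i → rows i ≢ u

  record History {m} (rows cols : Fin m → Fin n) (σ : Fin n → Fin n) (diag : Fin n → Bool) : Set where
    field
      rows-injective   : Injective _≡_ _≡_ rows
      cols-injective   : Injective _≡_ _≡_ cols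
      chosen-removed   : ∀ {u} → Expanded rows u → ∀ k → cols k ≢ σ u
      chosen-injective : ∀ {u w} → Expanded rows u → Expanded rows w → σ u ≡ σ w → u ≡ w
      diag-fixed       : ∀ {u} → Expanded rows u → diag u ≡ true → σ u ≡ u
      offdiag-edge     : ∀ {u} → Expanded rows u → diag u ≡ false → E u (σ u) ≡ true
      diag-expanded    : ∀ {u} → diag u ≡ true → Expanded rows u

  initial : History id id id (const false)
  initial = record
    { rows-injective   = id
    ; cols-injective   = id
    ; chosen-removed   = λ {u} u-exp → ⊥-elim (u-exp u refl)
    ; chosen-injective = λ {u} u-exp → ⊥-elim (u-exp u refl)
    ; diag-fixed       = λ {u} u-exp → ⊥-elim (u-exp u refl)
    ; offdiag-edge     = λ {u} u-exp → ⊥-elim (u-exp u refl)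
    ; diag-expanded    = λ ()
    }

  module Expand {m} {rows cols : Fin (suc m) → Fin n} {σ diag} (h : History rows cols σ diag)
                (j : Fin (suc m)) where
    open History h

    p : Fin n
    p = rows zero

    rows′ cols′ : Fin m → Fin n
    rows′ = rows ∘ suc
    cols′ = cols ∘ punchIn j

    σ′ : Fin n → Fin n
    σ′ = update σ p (cols j)

    p-expanded : Expanded rows′ p
    p-expanded i eq with rows-injective eq
    ... | ()

    p-not-expanded : ¬ Expanded rows p
    p-not-expanded p-exp = p-exp zero refl

    expanded′ : ∀ {u} → Expanded rows′ u → u ≡ p ⊎ (Expanded rows u × u ≢ p)
    expanded′ {u} u-exp with u ≟ p
    ... | yes u≡p = inj₁ u≡p
    ... | no  u≢p = inj₂ ((λ { zero → u≢p ∘ sym ; (suc i) → u-exp i }) , u≢p)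

    σ′-p : σ′ p ≡ cols j
    σ′-p = update-same σ p (cols j)

    σ′-other : ∀ {u} → u ≢ p → σ′ u ≡ σ u
    σ′-other = update-other σ p (cols j)

    still-expanded : ∀ {u} → Expanded rows u → Expanded rows′ u
    still-expanded u-exp i = u-exp (suc i)

    chosen-removed′ : ∀ {u} → Expanded rows′ u → ∀ k → cols′ k ≢ σ′ u
    chosen-removed′ u-exp k eq with expanded′ u-exp
    ... | inj₁ refl          = punchInᵢ≢i j k (cols-injective (trans eq σ′-p))
    ... | inj₂ (u-exp₀ , u≢p) = chosen-removed u-exp₀ (punchIn j k) (trans eq (σ′-other u≢p))

    chosen-injective′ : ∀ {u w} → Expanded rows′ u → Expanded rows′ w → σ′ u ≡ σ′ w → u ≡ w
    chosen-injective′ u-exp w-exp eq with expanded′ u-exp | expanded′ w-exp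
    ... | inj₁ refl           | inj₁ refl           = refl
    ... | inj₁ refl           | inj₂ (w-exp₀ , w≢p) =
      ⊥-elim (chosen-removed w-exp₀ j (trans (sym σ′-p) (trans eq (σ′-other w≢p))))
    ... | inj₂ (u-exp₀ , u≢p) | inj₁ refl           =
      ⊥-elim (chosen-removed u-exp₀ j (trans (sym σ′-p) (trans (sym eq) (σ′-other u≢p))))
    ... | inj₂ (u-exp₀ , u≢p) | inj₂ (w-exp₀ , w≢p) =
      chosen-injective u-exp₀ w-exp₀ (trans (sym (σ′-other u≢p)) (trans eq (σ′-other w≢p)))

    diag-p : diag p ≡ false
    diag-p with diag p in eq
    ... | true  = ⊥-elim (p-not-expanded (diag-expanded eq))
    ... | false = refl

    along-edge : E p (cols j) ≡ true → History rows′ cols′ σ′ diag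
    along-edge edge = record
      { rows-injective   = suc-injective ∘ rows-injective
      ; cols-injective   = punchIn-injective j _ _ ∘ cols-injective
      ; chosen-removed   = chosen-removed′
      ; chosen-injective = chosen-injective′
      ; diag-fixed       = diag-fixed′
      ; offdiag-edge     = offdiag-edge′
      ; diag-expanded    = still-expanded ∘ diag-expanded
      }
      where
      diag-fixed′ : ∀ {u} → Expanded rows′ u → diag u ≡ true → σ′ u ≡ u
      diag-fixed′ u-exp du with expanded′ u-exp
      ... | inj₁ refl           = ⊥-elim (p-not-expanded (diag-expanded du))
      ... | inj₂ (u-exp₀ , u≢p) = trans (σ′-other u≢p) (diag-fixed u-exp₀ du)
      offdiag-edge′ : ∀ {u} → Expanded rows′ u → diag u ≡ false → E u (σ′ u) ≡ true
      offdiag-edge′ u-exp du with expanded′ u-exp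
      ... | inj₁ refl           = subst (λ v → E p v ≡ true) (sym σ′-p) edge
      ... | inj₂ (u-exp₀ , u≢p) = subst (λ v → E _ v ≡ true) (sym (σ′-other u≢p)) (offdiag-edge u-exp₀ du)

    diag′ : Fin n → Bool
    diag′ = update diag p true

    count-diag′ : count diag′ ≡ suc (count diag)
    count-diag′ = count-update diag p diag-p

    along-diagonal : p ≡ cols j → History rows′ cols′ σ′ diag′
    along-diagonal p≡col = record
      { rows-injective   = suc-injective ∘ rows-injective
      ; cols-injective   = punchIn-injective j _ _ ∘ cols-injective
      ; chosen-removed   = chosen-removed′
      ; chosen-injective = chosen-injective′
      ; diag-fixed       = diag-fixed′
      ; offdiag-edge     = offdiag-edge′
      ; diag-expanded    = diag-expanded′
      }
      where
      diag-fixed′ : ∀ {u} → Expanded rows′ u → diag′ u ≡ true → σ′ u ≡ u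
      diag-fixed′ u-exp du with expanded′ u-exp
      ... | inj₁ refl           = trans σ′-p (sym p≡col)
      ... | inj₂ (u-exp₀ , u≢p) =
        trans (σ′-other u≢p) (diag-fixed u-exp₀ (trans (sym (update-other diag p true u≢p)) du))
      offdiag-edge′ : ∀ {u} → Expanded rows′ u → diag′ u ≡ false → E u (σ′ u) ≡ true
      offdiag-edge′ u-exp du with expanded′ u-exp
      ... | inj₁ refl           = case trans (sym (update-same diag p true)) du of λ ()
      ... | inj₂ (u-exp₀ , u≢p) =
        subst (λ v → E _ v ≡ true) (sym (σ′-other u≢p))
          (offdiag-edge u-exp₀ (trans (sym (update-other diag p true u≢p)) du))
      diag-expanded′ : ∀ {u} → diag′ u ≡ true → Expanded rows′ u
      diag-expanded′ {u} du with u ≟ p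
      ... | yes refl = p-expanded
      ... | no  _    = still-expanded (diag-expanded du)

  complete⇒disjointCycles : ∀ {rows cols : Fin 0 → Fin n} {σ diag} → History rows cols σ diag →
    Σ (List (List (Fin n))) λ cs → DisjointCycles E cs × covered cs ≡ count (not ∘ diag)
  complete⇒disjointCycles {σ = σ} {diag} h = cycle-decomposition E (not ∘ diag) invariant edges
    where
    open History h
    all-expanded : ∀ {u} → Expanded _ u
    all-expanded ()
    σ-injective : Injective _≡_ _≡_ σ
    σ-injective = chosen-injective all-expanded all-expanded
    open Orbits σ σ-injective
    -- a diagonal row is fixed by σ, so by injectivity it is the image of itself only
    invariant : Invariant (not ∘ diag)
    invariant u nd with diag (σ u) in dσu
    ... | false = refl
    ... | true  = ⊥-elim (not-¬ (trans (cong diag (sym σu≡u)) dσu) (not-injective nd))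
      where
      σu≡u : σ u ≡ u
      σu≡u = σ-injective (diag-fixed all-expanded dσu)
    edges : AlongEdges E (not ∘ diag)
    edges u nd = offdiag-edge all-expanded (not-injective nd)

module Sufficiency {c ℓ} (F : Field c ℓ) {n} (E : Graph n) {r} (r≤n : r ≤ n) (acyclic : RAcyclic E r)
                   (B : Matrix F n) (B∈S : InSpan F E B) where
  open Nat using (_+_)
  open ℕₚ using ( ≤-trans; ≤-reflexive; +-suc; +-identityʳ; +-comm; +-monoˡ-≤; m≤n+o⇒m∸n≤o
                ; m∸[m∸n]≡n; <⇒≱; m≤n+m; module ≤-Reasoning)
  open Field F using (_≈_; -_; 0#; refl; trans; reflexive; -‿cong; ring)
  open import Algebra.Properties.Ring ring using (-0#≈0#)
  open PolynomialCoefficients F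
  open DeterminantCoefficients F
  open ExpansionHistory E

  complete-bound : ∀ {rows cols : Fin 0 → Fin n} {σ diag} → History rows cols σ diag → r ≤ count diag
  complete-bound {diag = diag} h with complete⇒disjointCycles h
  ... | cs , disjoint , covers = begin
    r                                           ≡⟨ m∸[m∸n]≡n r≤n ⟨
    n ∸ (n ∸ r)                                 ≤⟨ m≤n+o⇒m∸n≤o n (n ∸ r) n≤ ⟩
    count diag                                  ∎
    where
    open ≤-Reasoning
    n≤ : n ≤ (n ∸ r) + count diag
    n≤ = begin
      n                                         ≡⟨ count-complement diag ⟨
      count diag + count (not ∘ diag)           ≡⟨ +-comm (count diag) _ ⟩
      count (not ∘ diag) + count diag           ≡⟨ ≡.cong (_+ count diag) covers ⟨
      covered cs + count diag                   ≤⟨ +-monoˡ-≤ (count diag) (acyclic cs disjoint) ⟩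
      (n ∸ r) + count diag                      ∎

  non-edge-zero : ∀ {u v} → E u v ≡ false → - B u v ≈ 0#
  non-edge-zero {u} {v} no-edge =
    trans (-‿cong (trans (proj₂ B∈S u v) (reflexive (≡.cong (λ b → if b then _ else 0#) no-edge)))) -0#≈0#

  -- Each x taken on the diagonal raises the degree by one, hence the budget k + count diag ≤ r.
  expansion-vanishes : ∀ m {rows cols : Fin m → Fin n} {σ diag} → History rows cols σ diag →
    ∀ k → k + count diag ≤ r → VanishesBelow (charMinorCoeff B rows cols) k
  expansion-vanishes zero {diag = diag} h (suc k) k+diag≤r zero _ =
    contradiction (complete-bound h) (<⇒≱ (≤-trans (s≤s (m≤n+m (count diag) k)) k+diag≤r))
  expansion-vanishes zero    h k       k+diag≤r (suc d) _ = refl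
  expansion-vanishes (suc m) {rows} {cols} {diag = diag} h k k+diag≤r =
    charMinorCoeff-vanishesBelow B rows cols λ j →
      mulLinear-vanishesBelow (edge-term j) (diagonal-term j (rows zero ≟ cols j))
    where
    module Step = Expand h

    edge-term : ∀ j →
      - B (rows zero) (cols j) ≈ 0# ⊎ VanishesBelow (charMinorCoeff B (rows ∘ suc) (cols ∘ punchIn j)) k
    edge-term j with E (rows zero) (cols j) in edge
    ... | false = inj₁ (non-edge-zero edge)
    ... | true  = inj₂ (expansion-vanishes m (Step.along-edge j edge) k k+diag≤r)

    diagonal-vanishes : ∀ j → rows zero ≡ cols j → ∀ k → k + count diag ≤ r →
      VanishesBelow (shift (charMinorCoeff B (rows ∘ suc) (cols ∘ punchIn j))) k
    diagonal-vanishes j p≡col zero    _        _ ()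
    diagonal-vanishes j p≡col (suc k) k+diag≤r =
      vanishesBelow-shift (expansion-vanishes m (Step.along-diagonal j p≡col) k
        (≤-trans (≤-reflexive (≡.trans (≡.cong (k +_) (Step.count-diag′ j)) (+-suc k _))) k+diag≤r))

    diagonal-term : ∀ j → Dec (rows zero ≡ cols j) →
      δ (rows zero) (cols j) ≈ 0# ⊎ VanishesBelow (shift (charMinorCoeff B (rows ∘ suc) (cols ∘ punchIn j))) k
    diagonal-term j (no  p≢col) = inj₁ (δ-≢ p≢col)
    diagonal-term j (yes p≡col) = inj₂ (diagonal-vanishes j p≡col k k+diag≤r)

  zero-eigenvalues : AtLeastZeroEigs F r B
  zero-eigenvalues = vanishesBelow⇒Xpow∣ₚ r (charPoly F B) λ d d<r →
    trans (coeff-charPoly B d) (expansion-vanishes n initial r (≤-reflexive r+0≡r) d d<r)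
    where
    r+0≡r : r + count {n} (const false) ≡ r
    r+0≡r = ≡.trans (≡.cong (r +_) (count-false {n} (const false) λ _ → ≡.refl)) (+-identityʳ r)

module Successor {n : ℕ} where
  open ≡ using (refl; sym; trans)

  Arc : Set
  Arc = Fin n × Fin n

  successor : List Arc → Fin n → Fin n
  successor []            u = u
  successor ((a , b) ∷ Q) u = if does (u ≟ a) then b else successor Q u

  successor-∈ : ∀ Q {u} → u ∈ map proj₁ Q → (u , successor Q u) ∈ Q
  successor-∈ ((a , b) ∷ Q) {u} u∈ with u ≟ a | u∈
  ... | yes refl | _          = here refl
  ... | no  u≢a  | here u≡a   = ⊥-elim (u≢a u≡a)
  ... | no  _    | there u∈Q  = there (successor-∈ Q u∈Q)

  successor-∉ : ∀ Q {u} → u ∉ map proj₁ Q → successor Q u ≡ u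
  successor-∉ []            u∉ = refl
  successor-∉ ((a , b) ∷ Q) {u} u∉ with u ≟ a
  ... | yes refl = ⊥-elim (u∉ (here refl))
  ... | no  _    = successor-∉ Q (u∉ ∘ there)

  unique-map-injective : ∀ {b} {B : Set b} (f : Arc → B) Q {x y} → Unique (map f Q) →
    x ∈ Q → y ∈ Q → f x ≡ f y → x ≡ y
  unique-map-injective f (q ∷ Q) _          (here refl) (here refl) _   = refl
  unique-map-injective f (q ∷ Q) (q∉ ∷ _)   (here refl) (there y∈)  eq  = ⊥-elim (lookup q∉ (∈-map⁺ f y∈) eq)
  unique-map-injective f (q ∷ Q) (q∉ ∷ _)   (there x∈)  (here refl) eq  = ⊥-elim (lookup q∉ (∈-map⁺ f x∈) (sym eq))
  unique-map-injective f (q ∷ Q) (_ ∷ uniq) (there x∈)  (there y∈)  eq  = unique-map-injective f Q uniq x∈ y∈ eq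

  successor-closed : ∀ Q → (∀ {x} → x ∈ map proj₂ Q → x ∈ map proj₁ Q) →
    ∀ {u} → u ∈ map proj₁ Q → successor Q u ∈ map proj₁ Q
  successor-closed Q targets⊆sources u∈ = targets⊆sources (∈-map⁺ proj₂ (successor-∈ Q u∈))

  successor-injective : ∀ Q → Unique (map proj₂ Q) → (∀ {x} → x ∈ map proj₂ Q → x ∈ map proj₁ Q) →
    Injective _≡_ _≡_ (successor Q)
  successor-injective Q uniq ⊆sources {u} {w} eq with u ∈? map proj₁ Q | w ∈? map proj₁ Q
  ... | yes u∈ | yes w∈ = cong proj₁ (unique-map-injective proj₂ Q uniq (successor-∈ Q u∈) (successor-∈ Q w∈) eq)
  ... | yes u∈ | no  w∉ = ⊥-elim (w∉ (subst (_∈ _) (trans eq (successor-∉ Q w∉)) (successor-closed Q ⊆sources u∈)))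
  ... | no  u∉ | yes w∈ = ⊥-elim (u∉ (subst (_∈ _) (trans (sym eq) (successor-∉ Q u∉)) (successor-closed Q ⊆sources w∈)))
  ... | no  u∉ | no  w∉ = trans (sym (successor-∉ Q u∉)) (trans eq (successor-∉ Q w∉))

module CycleArcs {n} (E : Graph n) where
  open ≡ using (refl; sym; trans; setoid)
  open Successor {n}

  walkArcs : Fin n → Fin n → List (Fin n) → List Arc
  walkArcs s c []       = (c , s) ∷ []
  walkArcs s c (w ∷ ws) = (c , w) ∷ walkArcs s w ws

  cycleArcs : List (Fin n) → List Arc
  cycleArcs []       = []
  cycleArcs (v ∷ vs) = walkArcs v v vs

  sources-walkArcs : ∀ s c vs → map proj₁ (walkArcs s c vs) ≡ c ∷ vs
  sources-walkArcs s c []       = refl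
  sources-walkArcs s c (w ∷ ws) = cong (c ∷_) (sources-walkArcs s w ws)

  targets-walkArcs : ∀ s c vs → map proj₂ (walkArcs s c vs) ≡ vs ++ s ∷ []
  targets-walkArcs s c []       = refl
  targets-walkArcs s c (w ∷ ws) = cong (w ∷_) (targets-walkArcs s w ws)

  sources-cycleArcs : ∀ c → map proj₁ (cycleArcs c) ≡ c
  sources-cycleArcs []       = refl
  sources-cycleArcs (v ∷ vs) = sources-walkArcs v v vs

  targets-cycleArcs : ∀ c → map proj₂ (cycleArcs c) ↭ c
  targets-cycleArcs []       = ↭-refl
  targets-cycleArcs (v ∷ vs) = subst (_↭ v ∷ vs) (sym (targets-walkArcs v v vs)) (↭-sym (↭.∷↭∷ʳ v vs))

  sources-arcs : ∀ cs → map proj₁ (concatMap cycleArcs cs) ≡ concat cs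
  sources-arcs []       = refl
  sources-arcs (c ∷ cs) =
    trans (map-++ proj₁ (cycleArcs c) _) (cong₂ _++_ (sources-cycleArcs c) (sources-arcs cs))

  targets-arcs : ∀ cs → map proj₂ (concatMap cycleArcs cs) ↭ concat cs
  targets-arcs []       = ↭-refl
  targets-arcs (c ∷ cs) = subst (_↭ concat (c ∷ cs)) (sym (map-++ proj₂ (cycleArcs c) _))
    (↭.++⁺ (targets-cycleArcs c) (targets-arcs cs))

  IsEdge : Arc → Set
  IsEdge (u , v) = E u v ≡ true

  walkArcs-edges : ∀ s c vs → Walk E s c vs → All IsEdge (walkArcs s c vs)
  walkArcs-edges s c []       back          = back ∷ []
  walkArcs-edges s c (w ∷ ws) (edge , walk) = edge ∷ walkArcs-edges s w ws walk

  arcs-edges : ∀ cs → All (IsCycle E) cs → All IsEdge (concatMap cycleArcs cs)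
  arcs-edges []              []             = []
  arcs-edges ((v ∷ vs) ∷ cs) (cycle ∷ cycles) = Allₚ.++⁺ (walkArcs-edges v v vs cycle) (arcs-edges cs cycles)

  module CyclePermutation (cs : List (List (Fin n))) (disjoint : DisjointCycles E cs) where

    arcs : List Arc
    arcs = concatMap cycleArcs cs

    next : Fin n → Fin n
    next = successor arcs

    onCycle : Fin n → Bool
    onCycle u = does (u ∈? concat cs)

    next-injective : Injective _≡_ _≡_ next
    next-injective = successor-injective arcs
      (Unique-resp-↭ (setoid (Fin n)) (↭⇒↭ₛ (↭-sym (targets-arcs cs))) (proj₂ disjoint))
      (λ x∈ → subst (_ ∈_) (sym (sources-arcs cs)) (↭.∈-resp-↭ (targets-arcs cs) x∈))

    next-edge : ∀ {u} → onCycle u ≡ true → E u (next u) ≡ true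
    next-edge {u} on = lookup (arcs-edges cs (proj₁ disjoint))
      (successor-∈ arcs (subst (u ∈_) (sym (sources-arcs cs)) (does-true⇒ (u ∈? concat cs) on)))

    next-off-cycle : ∀ {u} → onCycle u ≡ false → next u ≡ u
    next-off-cycle {u} off = successor-∉ arcs λ u∈ →
      case trans (sym (dec-true (u ∈? concat cs) (subst (u ∈_) (sources-arcs cs) u∈))) off of λ ()

    count-onCycle : count onCycle ≡ covered cs
    count-onCycle = count-∈ (concat cs) (proj₂ disjoint)

module Necessity {c ℓ} (F : Field c ℓ) {n} (E : Graph n)
                 (cs : List (List (Fin n))) (disjoint : DisjointCycles E cs) where
  open Field F hiding (zero)
  open ℕₚ using (n<1+n; n≤1+n; ∸-cancelʳ-<; m+n∸n≡m)
  open import Algebra.Properties.Ring ring using (-0#≈0#; -1*x≈-x)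
  open import Relation.Binary.Reasoning.Setoid setoid
  open PolynomialCoefficients F
  open DeterminantCoefficients F
  open CycleArcs E
  open CyclePermutation cs disjoint

  weight : Matrix F n
  weight u v = if onCycle u ∧ does (next u ≟ v) then 1# else 0#

  -- the permutation matrix of the cycles; testing E u v makes membership in S_G definitional
  B : Matrix F n
  B u v = if E u v then weight u v else 0#

  B∈S : InSpan F E B
  B∈S = weight , λ _ _ → refl

  -B : Matrix F n
  -B u v = - B u v

  -B-zero : ∀ {u v} → (onCycle u ∧ does (next u ≟ v)) ≡ false → -B u v ≈ 0#
  -B-zero {u} {v} off = trans (-‿cong B≈0) -0#≈0#
    where
    B≈0 : B u v ≈ 0#
    B≈0 with E u v
    ... | false = refl
    ... | true rewrite off = refl

  -B-off-cycle : ∀ {u v} → onCycle u ≡ false → -B u v ≈ 0#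
  -B-off-cycle {u} {v} off = -B-zero (≡.cong (_∧ does (next u ≟ v)) off)

  -B-not-next : ∀ {u v} → v ≢ next u → -B u v ≈ 0#
  -B-not-next {u} {v} v≢next =
    -B-zero (≡.trans (≡.cong (onCycle u ∧_) (dec-false (next u ≟ v) (v≢next ∘ ≡.sym))) (∧-zeroʳ _))

  -B-next : ∀ {u} → onCycle u ≡ true → -B u (next u) ≈ - 1#
  -B-next {u} on rewrite next-edge on | on | dec-true (next u ≟ next u) ≡.refl = refl

  offCycleCount : ∀ {m} → (Fin m → Fin n) → ℕ
  offCycleCount rows = count (λ i → not (onCycle (rows i)))

  offCycle-vanishes : ∀ m (rows cols : Fin m → Fin n) → VanishesBelow (charMinorCoeff B rows cols) (offCycleCount rows)
  offCycle-vanishes zero    rows cols d ()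
  offCycle-vanishes (suc m) rows cols =
    charMinorCoeff-vanishesBelow B rows cols λ j → term j (onCycle (rows zero)) ≡.refl
    where
    term : ∀ j b → onCycle (rows zero) ≡ b →
      VanishesBelow (laplaceTerm B rows cols j)
                    ((if not b then 1 else 0) Nat.+ offCycleCount (rows ∘ suc))
    term j true  _   = mulLinear-vanishesBelow (inj₂ IH) (inj₂ (vanishesBelow-≤ (n≤1+n _) (vanishesBelow-shift IH)))
      where IH = offCycle-vanishes m (rows ∘ suc) (cols ∘ punchIn j)
    term j false off = mulLinear-vanishesBelow (inj₁ (-B-off-cycle off)) (inj₂ (vanishesBelow-shift IH))
      where IH = offCycle-vanishes m (rows ∘ suc) (cols ∘ punchIn j)

  -- Only the column j₀ holding next (rows zero) contributes: through -1 if the row lies on a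
  -- cycle, through the diagonal x otherwise (then next fixes the row).
  sign : ∀ m (rows cols : Fin m → Fin n) → Injective _≡_ _≡_ (next ∘ rows) → Injective _≡_ _≡_ cols →
    (∀ i → ∃ λ k → cols k ≡ next (rows i)) → IsSign (charMinorCoeff B rows cols (offCycleCount rows))
  sign zero    rows cols _ _ _ = inj₁ refl
  sign (suc m) rows cols next∘rows-injective cols-injective hits =
    IsSign-resp (sym (sumFin-single _ j₀ λ j j≢j₀ →
                        negPow-zero (toℕ j) (other-term j j≢j₀ (onCycle (rows zero)) ≡.refl)))
                (IsSign-negPow (toℕ j₀) (successor-term (onCycle (rows zero)) ≡.refl))
    where
    j₀ : Fin (suc m)
    j₀ = proj₁ (hits zero)
    col-j₀ : cols j₀ ≡ next (rows zero)
    col-j₀ = proj₂ (hits zero)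
    rows′ : Fin m → Fin n
    rows′ = rows ∘ suc

    d′ : ℕ
    d′ = offCycleCount rows′

    shift-term≈0 : ∀ j → shift (charMinorCoeff B rows′ (cols ∘ punchIn j)) d′ ≈ 0#
    shift-term≈0 j = vanishesBelow-shift (offCycle-vanishes m rows′ (cols ∘ punchIn j)) d′ (n<1+n d′)

    hits′ : ∀ i → ∃ λ k → cols (punchIn j₀ k) ≡ next (rows′ i)
    hits′ i = punchOut j₀≢k , ≡.trans (≡.cong cols (punchIn-punchOut j₀≢k)) (proj₂ (hits (suc i)))
      where
      j₀≢k : j₀ ≢ proj₁ (hits (suc i))
      j₀≢k j₀≡k with next∘rows-injective (≡.trans (≡.sym col-j₀) (≡.trans (≡.cong cols j₀≡k) (proj₂ (hits (suc i)))))
      ... | ()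

    IH : IsSign (charMinorCoeff B rows′ (cols ∘ punchIn j₀) d′)
    IH = sign m rows′ (cols ∘ punchIn j₀) (suc-injective ∘ next∘rows-injective)
           (punchIn-injective j₀ _ _ ∘ cols-injective) hits′

    successor-term : ∀ b → onCycle (rows zero) ≡ b →
      IsSign (laplaceTerm B rows cols j₀ ((if not b then 1 else 0) Nat.+ d′))
    successor-term true on = IsSign-resp (sym (begin
      laplaceTerm B rows cols j₀ d′                         ≈⟨ +-congˡ (trans (*-congˡ (shift-term≈0 j₀)) (zeroʳ _)) ⟩
      -B (rows zero) (cols j₀) * charMinorCoeff B rows′ _ d′ + 0#
                                                            ≈⟨ +-identityʳ _ ⟩
      -B (rows zero) (cols j₀) * charMinorCoeff B rows′ _ d′ ≈⟨ *-congʳ (trans (reflexive (≡.cong (-B _) col-j₀)) (-B-next on)) ⟩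
      - 1# * charMinorCoeff B rows′ _ d′                    ≈⟨ -1*x≈-x _ ⟩
      - charMinorCoeff B rows′ _ d′                         ∎)) (IsSign-neg IH)
    successor-term false off = IsSign-resp (sym (begin
      laplaceTerm B rows cols j₀ (suc d′)                   ≈⟨ +-congʳ (trans (*-congʳ (-B-off-cycle off)) (zeroˡ _)) ⟩
      0# + δ (rows zero) (cols j₀) * charMinorCoeff B rows′ _ d′
                                                            ≈⟨ +-identityˡ _ ⟩
      δ (rows zero) (cols j₀) * charMinorCoeff B rows′ _ d′ ≈⟨ *-congʳ δ≈1 ⟩
      1# * charMinorCoeff B rows′ _ d′                      ≈⟨ *-identityˡ _ ⟩
      charMinorCoeff B rows′ _ d′                           ∎)) IH
      where
      δ≈1 : δ (rows zero) (cols j₀) ≈ 1#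
      δ≈1 rewrite col-j₀ | next-off-cycle off = δ-≡ (rows zero)

    other-term : ∀ j → j ≢ j₀ → ∀ b → onCycle (rows zero) ≡ b →
      laplaceTerm B rows cols j ((if not b then 1 else 0) Nat.+ d′) ≈ 0#
    other-term j j≢j₀ true  on  = trans (+-cong (trans (*-congʳ (-B-not-next col≢next)) (zeroˡ _))
                                               (trans (*-congˡ (shift-term≈0 j)) (zeroʳ _))) (+-identityˡ 0#)
      where
      col≢next : cols j ≢ next (rows zero)
      col≢next eq = j≢j₀ (cols-injective (≡.trans eq (≡.sym col-j₀)))
    other-term j j≢j₀ false off = trans (+-cong (trans (*-congʳ (-B-off-cycle off)) (zeroˡ _))
                                               (trans (*-congʳ (δ-≢ row≢col)) (zeroˡ _))) (+-identityˡ 0#)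
      where
      row≢col : rows zero ≢ cols j
      row≢col eq = j≢j₀ (cols-injective (≡.trans (≡.sym eq) (≡.trans (≡.sym (next-off-cycle off)) (≡.sym col-j₀))))

  no-zero-eigenvalues : ∀ {r} → n ∸ r < covered cs → ¬ AtLeastZeroEigs F r B
  no-zero-eigenvalues {r} n∸r<covered x^r∣χ =
    IsSign⇒≉0 (IsSign-resp (sym (coeff-charPoly B k)) coeff-sign)
      (Xpow∣ₚ⇒vanishesBelow r (charPoly F B) x^r∣χ k k<r)
    where
    k : ℕ
    k = offCycleCount id
    coeff-sign : IsSign (charMinorCoeff B id id k)
    coeff-sign = sign n id id next-injective id (λ i → next i , ≡.refl)
    n∸k≡covered : n ∸ k ≡ covered cs
    n∸k≡covered = ≡.trans (≡.cong (_∸ k) (≡.sym (count-complement onCycle)))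
                    (≡.trans (m+n∸n≡m (count onCycle) k) count-onCycle)
    k<r : k < r
    k<r = ∸-cancelʳ-< (≡.subst (n ∸ r <_) (≡.sym n∸k≡covered) n∸r<covered)

theorem4p4 : ∀ {c ℓ} (F : Field c ℓ) (n : ℕ) (E : Graph n) (r : ℕ) → r ≤ n →
    (RAcyclic E r → ∀ B → InSpan F E B → AtLeastZeroEigs F r B)
      × ((∀ B → InSpan F E B → AtLeastZeroEigs F r B) → RAcyclic E r)
theorem4p4 F n E r r≤n = sufficient , necessary
  where
  sufficient : RAcyclic E r → ∀ B → InSpan F E B → AtLeastZeroEigs F r B
  sufficient acyclic B B∈S = Sufficiency.zero-eigenvalues F E r≤n acyclic B B∈S

  necessary : (∀ B → InSpan F E B → AtLeastZeroEigs F r B) → RAcyclic E r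
  necessary zero-eigenvalues cs disjoint with covered cs Nat.≤? n ∸ r
  ... | yes covered≤ = covered≤
  ... | no  covered≰ = contradiction (zero-eigenvalues B B∈S) (no-zero-eigenvalues {r} (ℕₚ.≰⇒> covered≰))
    where open Necessity F E cs disjoint
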